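{- Let $p$ be a prime, $d\in\mathbb{N}$, and $G=C_{p^{e_1}}\times C_{p^{e_2}}\times\cdots\times C_{p^{e_d}}$ with $1\le e_i\le e_{i+1}$ for $i\in[1,d-1]$. If $p^{e_d}\ge 1+\sum_{i=1}^{d-1}(p^{e_i}-1)$, then $\eta(G)\le D(G)+\exp(G)$.
   Context: All groups are finite abelian, written additively; $C_n$ is the cyclic group of order $n$; $\exp(G)$ is the exponent of $G$. A sequence over $G$ is a finite multiset of elements of $G$; a sequence is zero-sum if the sum of its terms is $0$; a short zero-sum sequence is a zero-sum sequence of length in $[1,\exp(G)]$. $D(G)$ is the least positive integer $k$ such that every sequence over $G$ of length at least $k$ has a nonempty zero-sum subsequence; $\eta(G)$ is the least positive integer $k$ such that every sequence over $G$ of length at least $k$ has a short zero-sum subsequence. -}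

module Defs where

open import Data.Nat using (ℕ; zero; suc; _+_; _*_; _∸_; _^_; _≤_; _<_)
open import Data.Nat.Divisibility using (_∣_)
open import Data.Fin using (Fin; toℕ; fromℕ; inject₁)
open import Data.List using (List; []; _∷_; length)
open import Data.List.Relation.Binary.Sublist.Propositional using (_⊆_)
open import Data.Product using (Σ; _×_; _,_)
open import Relation.Nullary using (¬_)
open import Relation.Binary.PropositionalEquality using (_≡_)

ΣFin : (n : ℕ) → (Fin n → ℕ) → ℕ
ΣFin zero    f = 0
ΣFin (suc n) f = f Data.Fin.zero + ΣFin n (λ i → f (Data.Fin.suc i))

module Group (p d : ℕ) (e : Fin d → ℕ) where

  Elem : Set
  Elem = (i : Fin d) → Fin (p ^ e i)

  -- sequences over G (finite multisets, represented as lists)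
  Seq : Set
  Seq = List Elem

  coordSum : Seq → Fin d → ℕ
  coordSum []      i = 0
  coordSum (g ∷ S) i = toℕ (g i) + coordSum S i

  ZeroSum : Seq → Set
  ZeroSum S = (i : Fin d) → p ^ e i ∣ coordSum S i

  KillsElem : ℕ → Elem → Set
  KillsElem n g = (i : Fin d) → p ^ e i ∣ n * toℕ (g i)

  IsExp : ℕ → Set
  IsExp n = 1 ≤ n × ((g : Elem) → KillsElem n g)
            × ((m : ℕ) → 1 ≤ m → ((g : Elem) → KillsElem m g) → n ≤ m)

  DProp : ℕ → Set
  DProp k = (S : Seq) → k ≤ length S →
            Σ Seq (λ T → T ⊆ S × 1 ≤ length T × ZeroSum T)

  IsDavenport : ℕ → Set
  IsDavenport k = 1 ≤ k × DProp k × ((m : ℕ) → 1 ≤ m → DProp m → k ≤ m)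

  EtaProp : ℕ → ℕ → Set
  EtaProp ex k = (S : Seq) → k ≤ length S →
                 Σ Seq (λ T → T ⊆ S × 1 ≤ length T × length T ≤ ex × ZeroSum T)

  IsEta : ℕ → ℕ → Set
  IsEta ex k = 1 ≤ k × EtaProp ex k × ((m : ℕ) → 1 ≤ m → EtaProp ex m → k ≤ m)

module Submission where

open import Defs using (ΣFin; module Group)
open import Data.Nat as ℕ using (ℕ; zero; suc; _∸_; _^_; _≤_; _<_; s≤s; z≤n; nonTrivial⇒n>1)
import Data.Nat.Properties as ℕ
open import Algebra.Properties.CommutativeSemigroup ℕ.+-commutativeSemigroup using (x∙yz≈y∙xz)
open import Data.Nat.Divisibility
  using (_∣_; _∣?_; divides; 1∣_; ∣-refl; ∣⇒≤; ∣m+n∣m⇒∣n; ∣1⇒≡1; m*n∣⇒m∣; *-monoʳ-∣; *-cancelˡ-∣)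
open import Data.Nat.Primality using (Prime; ¬prime[1]; euclidsLemma; prime⇒nonZero; prime⇒nonTrivial)
open import Data.Nat.Combinatorics using (_C_; nC1≡n; nCn≡1; nCk+nC[k+1]≡[n+1]C[k+1])
open import Data.Bool using (true; false; if_then_else_)
open import Data.Fin as Fin using (Fin; toℕ; fromℕ<)
import Data.Fin.Properties as Fin
open import Data.List using (List; []; _∷_; length; map; replicate; _++_; take)
import Data.List.Properties as List
open import Data.List.Relation.Binary.Sublist.Propositional as Sublist
  using (_⊆_; []; _∷_; _∷ʳ_; ⊆-trans; minimum)
open import Data.List.Relation.Binary.Sublist.Propositional.Properties using (length-mono-≤; take-⊆)
open import Data.List.Relation.Unary.Any using (here)
open import Data.List.Membership.Propositional.Properties using (∈-map⁻)
open import Data.Vec as Vec using (Vec; []; _∷_; [_]; zipWith; head; tail; lookup; tabulate)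
import Data.Vec.Properties as Vec
open import Data.Product using (Σ; _×_; _,_; proj₁)
open import Data.Sum using (_⊎_; inj₁; inj₂)
open import Function using (_∘_; const)
open import Relation.Nullary using (¬_; contradiction; does; yes; no)
open import Relation.Nullary.Decidable using (decidable-stable; dec-true)
open import Relation.Unary using (Decidable)
open import Relation.Binary.PropositionalEquality hiding ([_])

-- Write d* = Σᵢ (p^eᵢ − 1) and q = p^e_d. Olson's bound D(G) ≤ d* + 1 comes from the polynomial method:
-- Φ(x) = Πᵢ C(xᵢ + p^eᵢ − 1, p^eᵢ − 1) has degree d*, equals 1 at 0 and is divisible by p at every
-- nonzero x ∈ G, so along a zero-sum-free sequence of length > d* its iterated finite difference at 0
-- would be both ≡ 1 (mod p) and 0. Given d* + q terms, apply this in C_q × G to the lifts g ↦ (1, g):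
-- some nonempty T is zero-sum in G with q ∣ |T| < 3q. If |T| = 2q, all but one term of T still exceed
-- d*, so they contain a nonempty zero-sum U, and U or its complement in T has length at most q. Hence
-- η(G) ≤ d* + q ≤ D(G) + exp(G), the last step because p^eᵢ − 1 copies of each unit vector form a
-- zero-sum-free sequence of length d*.

module Binomial where

  open import Data.Nat using (_+_; _*_)
  open import Data.Nat.Tactic.RingSolver using (solve-∀)

  [1+k]*[1+n]C[1+k]≡[1+n]*nCk : ∀ n k → suc k * (suc n C suc k) ≡ suc n * (n C k)
  [1+k]*[1+n]C[1+k]≡[1+n]*nCk zero    zero    = refl
  [1+k]*[1+n]C[1+k]≡[1+n]*nCk zero    (suc k) = ℕ.*-zeroʳ (2 + k)
  [1+k]*[1+n]C[1+k]≡[1+n]*nCk (suc n) zero    =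
    trans (ℕ.+-identityʳ _) (trans (nC1≡n (2 + n)) (sym (ℕ.*-identityʳ (2 + n))))
  [1+k]*[1+n]C[1+k]≡[1+n]*nCk (suc n) (suc k) = begin
    (2 + k) * (suc (suc n) C suc (suc k))
      ≡⟨ cong ((2 + k) *_) (nCk+nC[k+1]≡[n+1]C[k+1] (suc n) (suc k)) ⟨
    (2 + k) * (a + b)
      ≡⟨ split k a b ⟩
    ((1 + k) * a + (2 + k) * b) + a
      ≡⟨ cong (_+ a) (cong₂ _+_ ([1+k]*[1+n]C[1+k]≡[1+n]*nCk n k)
                                ([1+k]*[1+n]C[1+k]≡[1+n]*nCk n (suc k))) ⟩
    ((1 + n) * (n C k) + (1 + n) * (n C suc k)) + a
      ≡⟨ cong (_+ a) (ℕ.*-distribˡ-+ (1 + n) (n C k) (n C suc k)) ⟨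
    (1 + n) * (n C k + n C suc k) + a
      ≡⟨ cong (λ c → (1 + n) * c + a) (nCk+nC[k+1]≡[n+1]C[k+1] n k) ⟩
    (1 + n) * a + a
      ≡⟨ ℕ.+-comm _ a ⟩
    (2 + n) * a ∎
    where
    open ≡-Reasoning
    a = suc n C suc k
    b = suc n C suc (suc k)
    split : ∀ k a b → (2 + k) * (a + b) ≡ ((1 + k) * a + (2 + k) * b) + a
    split = solve-∀

  p^k∣m*n⇒p∤n⇒p^k∣m : ∀ {p} → Prime p → ∀ k m n → p ^ k ∣ m * n → ¬ p ∣ n → p ^ k ∣ m
  p^k∣m*n⇒p∤n⇒p^k∣m pr zero    m n _ _ = 1∣ m
  p^k∣m*n⇒p∤n⇒p^k∣m {p} pr (suc k) m n p^[1+k]∣mn p∤n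
    with euclidsLemma m n pr (m*n∣⇒m∣ p (p ^ k) p^[1+k]∣mn)
  ... | inj₂ p∣n = contradiction p∣n p∤n
  ... | inj₁ (divides m′ refl) = subst (p * p ^ k ∣_) (ℕ.*-comm p m′) (*-monoʳ-∣ p p^k∣m′)
    where
    instance _ = prime⇒nonZero pr
    rearrange : ∀ m′ p n → m′ * p * n ≡ p * (m′ * n)
    rearrange = solve-∀
    p^k∣m′ : p ^ k ∣ m′
    p^k∣m′ = p^k∣m*n⇒p∤n⇒p^k∣m pr k m′ n
               (*-cancelˡ-∣ p (subst (p * p ^ k ∣_) (rearrange m′ p n) p^[1+k]∣mn)) p∤n

  -- By absorption p^k ∣ (x + p^k) · C(x + p^k − 1, p^k − 1); if p missed the binomial, p^k would divide x.
  p∣[x+p^k∸1]C[p^k∸1] : ∀ {p} → Prime p → ∀ k x → ¬ p ^ k ∣ x →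
                        p ∣ (x + (p ^ k ∸ 1)) C (p ^ k ∸ 1)
  p∣[x+p^k∸1]C[p^k∸1] {p} pr k x p^k∤x = decidable-stable (p ∣? c) λ p∤c →
    p^k∤x (∣m+n∣m⇒∣n (subst (p ^ k ∣_) (ℕ.+-comm x (p ^ k)) (p^k∣x+p^k p∤c)) ∣-refl)
    where
    instance _ = prime⇒nonZero pr
    M = p ^ k ∸ 1
    c = (x + M) C M
    1+M≡p^k : suc M ≡ p ^ k
    1+M≡p^k = ℕ.m+[n∸m]≡n (ℕ.m^n>0 p k)
    p^k∣x+p^k : ¬ p ∣ c → p ^ k ∣ x + p ^ k
    p^k∣x+p^k = p^k∣m*n⇒p∤n⇒p^k∣m pr k (x + p ^ k) c (divides (suc (x + M) C suc M) (begin
      (x + p ^ k) * c                  ≡⟨ cong (λ y → (x + y) * c) 1+M≡p^k ⟨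
      (x + suc M) * c                  ≡⟨ cong (_* c) (ℕ.+-suc x M) ⟩
      suc (x + M) * c                  ≡⟨ [1+k]*[1+n]C[1+k]≡[1+n]*nCk (x + M) M ⟨
      suc M * (suc (x + M) C suc M)    ≡⟨ ℕ.*-comm (suc M) _ ⟩
      (suc (x + M) C suc M) * suc M    ≡⟨ cong ((suc (x + M) C suc M) *_) 1+M≡p^k ⟩
      (suc (x + M) C suc M) * p ^ k    ∎))
      where open ≡-Reasoning

open Binomial

module Points where

  Point : ℕ → Set
  Point d = Vec ℕ d

  private variable
    d : ℕ

  origin : Point d
  origin = Vec.replicate _ 0

  _⊕_ : Point d → Point d → Point d
  _⊕_ = zipWith ℕ._+_

  ⊕-assoc : ∀ (x y z : Point d) → (x ⊕ y) ⊕ z ≡ x ⊕ (y ⊕ z)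
  ⊕-assoc = Vec.zipWith-assoc ℕ.+-assoc

  ⊕-comm : ∀ (x y : Point d) → x ⊕ y ≡ y ⊕ x
  ⊕-comm = Vec.zipWith-comm ℕ.+-comm

  ⊕-swap : ∀ (x y z : Point d) → (x ⊕ y) ⊕ z ≡ (x ⊕ z) ⊕ y
  ⊕-swap x y z = trans (⊕-assoc x y z) (trans (cong (x ⊕_) (⊕-comm y z)) (sym (⊕-assoc x z y)))

  ⊕-identityˡ : ∀ (x : Point d) → origin ⊕ x ≡ x
  ⊕-identityˡ = Vec.zipWith-identityˡ ℕ.+-identityˡ

  ⊕-identityʳ : ∀ (x : Point d) → x ⊕ origin ≡ x
  ⊕-identityʳ = Vec.zipWith-identityʳ ℕ.+-identityʳ

  σ : {A : Set} → (A → Point d) → List A → Point d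
  σ v []      = origin
  σ v (a ∷ T) = v a ⊕ σ v T

  IsZeroMod : (Fin d → ℕ) → Point d → Set
  IsZeroMod m x = ∀ i → m i ∣ lookup x i

  isZeroMod? : (m : Fin d → ℕ) → Decidable (IsZeroMod m)
  isZeroMod? m x = Fin.all? λ i → m i ∣? lookup x i

open Points

module FiniteDifferences where

  open import Data.Integer using (ℤ; +_; _+_; _-_; _*_; -_)
  import Data.Integer.Properties as ℤ
  open import Data.Integer.Tactic.RingSolver using (solve-∀)

  Fn : ℕ → Set
  Fn d = Point d → ℤ

  private variable
    d m k l : ℕ
    Φ Ψ : Fn d

  Δ : Point d → Fn d → Fn d
  Δ s Φ x = Φ x - Φ (x ⊕ s)

  data Degree≤ {d} : ℕ → Fn d → Set where
    constant : (∀ x y → Φ x ≡ Φ y) → Degree≤ 0 Φ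
    step     : (∀ s → Degree≤ k (Δ s Φ)) → Degree≤ (suc k) Φ

  Degree≤-resp : Φ ≗ Ψ → Degree≤ k Φ → Degree≤ k Ψ
  Degree≤-resp Φ≗Ψ (constant c) = constant λ x y → trans (sym (Φ≗Ψ x)) (trans (c x y) (Φ≗Ψ y))
  Degree≤-resp Φ≗Ψ (step D)     = step λ s → Degree≤-resp (λ x → cong₂ _-_ (Φ≗Ψ x) (Φ≗Ψ _)) (D s)

  Δ-constant : Degree≤ 0 Φ → ∀ s → Δ s Φ ≗ const (+ 0)
  Δ-constant {Φ = Φ} (constant c) s x = trans (cong (λ y → Φ x - y) (sym (c x (x ⊕ s)))) (ℤ.+-inverseʳ (Φ x))

  Degree≤-≗0 : Φ ≗ const (+ 0) → Degree≤ k Φ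
  Degree≤-≗0 {k = zero}  Φ≗0 = constant λ x y → trans (Φ≗0 x) (sym (Φ≗0 y))
  Degree≤-≗0 {k = suc k} Φ≗0 = step λ s → Degree≤-≗0 λ x → cong₂ _-_ (Φ≗0 x) (Φ≗0 _)

  Degree≤-+ : Degree≤ k Φ → Degree≤ k Ψ → Degree≤ k (λ x → Φ x + Ψ x)
  Degree≤-+ (constant c) (constant c′) = constant λ x y → cong₂ _+_ (c x y) (c′ x y)
  Degree≤-+ {Φ = Φ} {Ψ = Ψ} (step D) (step E) = step λ s →
    Degree≤-resp (λ x → sym (interchange (Φ x) (Ψ x) (Φ (x ⊕ s)) (Ψ (x ⊕ s)))) (Degree≤-+ (D s) (E s))
    where
    interchange : ∀ a b c d → (a + b) - (c + d) ≡ (a - c) + (b - d)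
    interchange = solve-∀

  Degree≤-neg : Degree≤ k Φ → Degree≤ k (λ x → - Φ x)
  Degree≤-neg (constant c) = constant λ x y → cong -_ (c x y)
  Degree≤-neg {Φ = Φ} (step D) = step λ s →
    Degree≤-resp (λ x → neg-sub (Φ x) (Φ (x ⊕ s))) (Degree≤-neg (D s))
    where
    neg-sub : ∀ a b → - (a - b) ≡ - a - - b
    neg-sub = solve-∀

  Degree≤-shift : ∀ t → Degree≤ k Φ → Degree≤ k (λ x → Φ (x ⊕ t))
  Degree≤-shift t (constant c) = constant λ x y → c (x ⊕ t) (y ⊕ t)
  Degree≤-shift {Φ = Φ} t (step D) = step λ s →
    Degree≤-resp (λ x → cong (λ y → Φ (x ⊕ t) - Φ y) (⊕-swap x t s)) (Degree≤-shift t (D s))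

  Degree≤-scale : Degree≤ 0 Φ → Degree≤ k Ψ → Degree≤ k (λ x → Φ x * Ψ x)
  Degree≤-scale (constant c) (constant c′) = constant λ x y → cong₂ _*_ (c x y) (c′ x y)
  Degree≤-scale {Φ = Φ} {Ψ = Ψ} Φ-const@(constant c) (step E) = step λ s →
    Degree≤-resp (λ x → trans (distrib (Φ x) (Ψ x) (Ψ (x ⊕ s)))
                              (cong (λ a → Φ x * Ψ x - a * Ψ (x ⊕ s)) (c x (x ⊕ s))))
      (Degree≤-scale Φ-const (E s))
    where
    distrib : ∀ a b c → a * (b - c) ≡ a * b - a * c
    distrib = solve-∀

  Degree≤-* : Degree≤ k Φ → Degree≤ l Ψ → Degree≤ (k ℕ.+ l) (λ x → Φ x * Ψ x)
  Degree≤-* {k = zero} D E = Degree≤-scale D E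
  Degree≤-* {k = suc k} {Φ = Φ} {l = zero} {Ψ = Ψ} D E =
    subst (λ n → Degree≤ n (λ x → Φ x * Ψ x)) (sym (ℕ.+-identityʳ (suc k)))
      (Degree≤-resp (λ x → ℤ.*-comm (Ψ x) (Φ x)) (Degree≤-scale E D))
  Degree≤-* {k = suc k} {Φ = Φ} {l = suc l} {Ψ = Ψ} (step D) (step E) = step λ s →
    Degree≤-resp (λ x → sym (product-rule (Φ x) (Ψ x) (Φ (x ⊕ s)) (Ψ (x ⊕ s))))
      (Degree≤-+ (Degree≤-* (D s) (step E))
                 (subst (λ n → Degree≤ n (λ x → Φ (x ⊕ s) * Δ s Ψ x)) (sym (ℕ.+-suc k l))
                        (Degree≤-* (Degree≤-shift {Φ = Φ} s (step D)) (E s))))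
    where
    product-rule : ∀ a b a′ b′ → a * b - a′ * b′ ≡ (a - a′) * b + a′ * (b - b′)
    product-rule = solve-∀

  Degree≤-∘ : (π : Point m → Point d) → (∀ x s → π (x ⊕ s) ≡ π x ⊕ π s) →
              Degree≤ k Φ → Degree≤ k (Φ ∘ π)
  Degree≤-∘ π π-additive (constant c) = constant λ x y → c (π x) (π y)
  Degree≤-∘ {Φ = Φ} π π-additive (step D) = step λ s →
    Degree≤-resp (λ x → cong (λ y → Φ (π x) - Φ y) (sym (π-additive x s)))
                 (Degree≤-∘ π π-additive (D (π s)))

  Degree≤-fromUnitΔ : {φ : Fn 1} → Degree≤ k (Δ [ 1 ] φ) → Degree≤ (suc k) φ
  Degree≤-fromUnitΔ {k} {φ} D = step λ { (t ∷ []) → Δ[t] t }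
    where
    Δ[t] : ∀ t → Degree≤ k (Δ [ t ] φ)
    Δ[t] zero    = Degree≤-≗0 λ x →
      trans (cong (λ y → φ x - φ y) (⊕-identityʳ x)) (ℤ.+-inverseʳ (φ x))
    Δ[t] (suc t) = Degree≤-resp telescope (Degree≤-+ (Δ[t] t) (Degree≤-shift [ t ] D))
      where
      telescope : ∀ x → Δ [ t ] φ x + Δ [ 1 ] φ (x ⊕ [ t ]) ≡ Δ [ suc t ] φ x
      telescope x = trans (cancel (φ x) (φ (x ⊕ [ t ])) (φ ((x ⊕ [ t ]) ⊕ [ 1 ])))
                          (cong (λ y → φ x - φ y)
                                (trans (⊕-assoc x [ t ] [ 1 ]) (cong (λ n → x ⊕ [ n ]) (ℕ.+-comm t 1))))
        where
        cancel : ∀ a b c → (a - b) + (b - c) ≡ a - c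
        cancel = solve-∀

  binomial : ℕ → Fn 1
  binomial N (m ∷ []) = + ((m ℕ.+ N) C N)

  Δ-binomial : ∀ N x → Δ [ 1 ] (binomial (suc N)) x ≡ - binomial N (x ⊕ [ 1 ])
  Δ-binomial N (m ∷ []) = begin
    + b - + ((m ℕ.+ 1 ℕ.+ suc N) C suc N) ≡⟨ cong (λ n → + b - + n) pascal ⟩
    + b - + (a ℕ.+ b)                     ≡⟨ cong (λ z → + b - z) (ℤ.pos-+ a b) ⟩
    + b - (+ a + + b)                     ≡⟨ cancel (+ a) (+ b) ⟩
    - + a                                 ∎
    where
    open ≡-Reasoning
    a = (m ℕ.+ 1 ℕ.+ N) C N
    b = (m ℕ.+ suc N) C suc N
    pascal : (m ℕ.+ 1 ℕ.+ suc N) C suc N ≡ a ℕ.+ b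
    pascal = begin
      (m ℕ.+ 1 ℕ.+ suc N) C suc N     ≡⟨ cong (_C suc N) (ℕ.+-suc (m ℕ.+ 1) N) ⟩
      suc (m ℕ.+ 1 ℕ.+ N) C suc N     ≡⟨ nCk+nC[k+1]≡[n+1]C[k+1] (m ℕ.+ 1 ℕ.+ N) N ⟨
      a ℕ.+ (m ℕ.+ 1 ℕ.+ N) C suc N   ≡⟨ cong (λ n → a ℕ.+ n C suc N) (ℕ.+-assoc m 1 N) ⟩
      a ℕ.+ b                         ∎
    cancel : ∀ a b → b - (a + b) ≡ - a
    cancel = solve-∀

  binomial-degree : ∀ N → Degree≤ N (binomial N)
  binomial-degree zero    = constant λ { (_ ∷ []) (_ ∷ []) → refl }
  binomial-degree (suc N) = Degree≤-fromUnitΔ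
    (Degree≤-resp (λ x → sym (Δ-binomial N x)) (Degree≤-neg (Degree≤-shift [ 1 ] (binomial-degree N))))

  binomialProduct : (Fin d → ℕ) → Fn d
  binomialProduct {zero}  N []       = + 1
  binomialProduct {suc d} N (x ∷ xs) = binomial (N Fin.zero) [ x ] * binomialProduct (N ∘ Fin.suc) xs

  binomialProduct-degree : (N : Fin d → ℕ) → Degree≤ (ΣFin d N) (binomialProduct N)
  binomialProduct-degree {zero}  N = constant λ { [] [] → refl }
  binomialProduct-degree {suc d} N = Degree≤-resp (λ { (_ ∷ _) → refl })
    (Degree≤-* (Degree≤-∘ (λ x → [ head x ]) (λ { (_ ∷ _) (_ ∷ _) → refl }) (binomial-degree (N Fin.zero)))
               (Degree≤-∘ tail (λ { (_ ∷ _) (_ ∷ _) → refl }) (binomialProduct-degree (N ∘ Fin.suc))))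

  binomialProduct-origin : (N : Fin d → ℕ) → binomialProduct N origin ≡ + 1
  binomialProduct-origin {zero}  N = refl
  binomialProduct-origin {suc d} N =
    cong₂ _*_ (cong +_ (nCn≡1 (N Fin.zero))) (binomialProduct-origin (N ∘ Fin.suc))

  module _ {A : Set} (v : A → Point d) where

    -- Expanded: iteratedΔ v S Φ = Σ_{T ⊆ S} (-1)^|T| Φ (σ v T).
    iteratedΔ : List A → Fn d → ℤ
    iteratedΔ []      Φ = Φ origin
    iteratedΔ (a ∷ S) Φ = iteratedΔ S (Δ (v a) Φ)

    iteratedΔ-resp : ∀ S → Φ ≗ Ψ → iteratedΔ S Φ ≡ iteratedΔ S Ψ
    iteratedΔ-resp []      Φ≗Ψ = Φ≗Ψ origin
    iteratedΔ-resp (a ∷ S) Φ≗Ψ = iteratedΔ-resp S λ x → cong₂ _-_ (Φ≗Ψ x) (Φ≗Ψ _)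

    iteratedΔ-0 : ∀ S → iteratedΔ S (const (+ 0)) ≡ + 0
    iteratedΔ-0 []      = refl
    iteratedΔ-0 (a ∷ S) = iteratedΔ-0 S

    iteratedΔ-linear : ∀ S Φ Ψ → iteratedΔ S (λ x → Φ x - Ψ x) ≡ iteratedΔ S Φ - iteratedΔ S Ψ
    iteratedΔ-linear []      Φ Ψ = refl
    iteratedΔ-linear (a ∷ S) Φ Ψ =
      trans (iteratedΔ-resp S λ x → interchange (Φ x) (Ψ x) (Φ (x ⊕ v a)) (Ψ (x ⊕ v a)))
            (iteratedΔ-linear S (Δ (v a) Φ) (Δ (v a) Ψ))
      where
      interchange : ∀ a b c d → (a - b) - (c - d) ≡ (a - c) - (b - d)
      interchange = solve-∀

    iteratedΔ-vanishes : Degree≤ k Φ → ∀ S → k < length S → iteratedΔ S Φ ≡ + 0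
    iteratedΔ-vanishes D@(constant _) (a ∷ S) _ = trans (iteratedΔ-resp S (Δ-constant D (v a))) (iteratedΔ-0 S)
    iteratedΔ-vanishes (step D) (a ∷ S) (s≤s k<|S|) = iteratedΔ-vanishes (D (v a)) S k<|S|

module Olson {p : ℕ} (p-prime : Prime p) where

  open import Data.Integer using (+_; _+_; _-_; _*_)
  import Data.Integer.Properties as ℤ
  open import Data.Integer.Divisibility.Signed as ℤ
    using (divides; ∣ᵤ⇒∣; ∣⇒∣ᵤ; ∣m⇒∣m*n; ∣n⇒∣m*n; ∣m∣n⇒∣m+n; ∣m∣n⇒∣m-n)
  open import Data.Integer.Tactic.RingSolver using (solve-∀)
  open FiniteDifferences

  private variable
    d : ℕ

  p∣binomialProduct : (f : Fin d → ℕ) → ∀ x → ¬ IsZeroMod (λ i → p ^ f i) x →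
                      + p ℤ.∣ binomialProduct (λ i → p ^ f i ∸ 1) x
  p∣binomialProduct {zero}  f []       x≢0 = contradiction (λ ()) x≢0
  p∣binomialProduct {suc d} f (x ∷ xs) x≢0 with p ^ f Fin.zero ∣? x
  ... | no p^f∤x = ∣m⇒∣m*n {m = head-factor} tail-factor
                     (∣ᵤ⇒∣ (p∣[x+p^k∸1]C[p^k∸1] p-prime (f Fin.zero) x p^f∤x))
    where
    head-factor = binomial (p ^ f Fin.zero ∸ 1) [ x ]
    tail-factor = binomialProduct (λ i → p ^ f (Fin.suc i) ∸ 1) xs
  ... | yes p^f∣x = ∣n⇒∣m*n (binomial (p ^ f Fin.zero ∸ 1) [ x ]) (p∣binomialProduct (f ∘ Fin.suc) xs λ xs≡0 →
                      x≢0 λ where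
                        Fin.zero    → p^f∣x
                        (Fin.suc i) → xs≡0 i)

  module _ {d} (f : Fin d → ℕ) {A : Set} (v : A → Point d) where

    private
      IsZero : Point d → Set
      IsZero = IsZeroMod (λ i → p ^ f i)

      N : Fin d → ℕ
      N i = p ^ f i ∸ 1

      Φ : Fn d
      Φ = binomialProduct N

    ZeroSubsum : Point d → List A → Set
    ZeroSubsum b S = Σ (List A) λ T → T ⊆ S × 1 ≤ length T × IsZero (b ⊕ σ v T)

    -- Unless b + σ v T is zero for some nonempty T ⊆ S, p divides every term of the expansion
    -- of iteratedΔ except Φ b (the one for T = []).
    zeroSubsum⊎congruence : ∀ S b → ZeroSubsum b S ⊎ + p ℤ.∣ iteratedΔ v S (λ x → Φ (b ⊕ x)) - Φ b
    zeroSubsum⊎congruence []      b = inj₂ (subst (+ p ℤ.∣_) (sym Φ[b⊕0]-Φb≡0) (divides (+ 0) refl))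
      where
      Φ[b⊕0]-Φb≡0 : Φ (b ⊕ origin) - Φ b ≡ + 0
      Φ[b⊕0]-Φb≡0 = trans (cong (λ y → Φ y - Φ b) (⊕-identityʳ b)) (ℤ.+-inverseʳ (Φ b))
    zeroSubsum⊎congruence (a ∷ S) b with zeroSubsum⊎congruence S b
    ... | inj₁ (T , T⊆S , T≢[] , z) = inj₁ (T , a ∷ʳ T⊆S , T≢[] , z)
    ... | inj₂ p∣X-Φb with zeroSubsum⊎congruence S (b ⊕ v a)
    ...   | inj₁ (T , T⊆S , _ , z) =
      inj₁ (a ∷ T , refl ∷ T⊆S , s≤s z≤n , subst IsZero (⊕-assoc b (v a) (σ v T)) z)
    ...   | inj₂ p∣Y-Φb+a with isZeroMod? (λ i → p ^ f i) (b ⊕ v a)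
    ...     | yes z =
      inj₁ (a ∷ [] , refl ∷ minimum S , s≤s z≤n , subst IsZero (cong (b ⊕_) (sym (⊕-identityʳ (v a)))) z)
    ...     | no nz = inj₂ (subst (+ p ℤ.∣_) (sym regroup)
                        (∣m∣n⇒∣m-n p∣X-Φb (∣m∣n⇒∣m+n p∣Y-Φb+a (p∣binomialProduct f (b ⊕ v a) nz))))
      where
      X = iteratedΔ v S (λ x → Φ (b ⊕ x))
      Y = iteratedΔ v S (λ x → Φ ((b ⊕ v a) ⊕ x))
      regroup : iteratedΔ v (a ∷ S) (λ x → Φ (b ⊕ x)) - Φ b
              ≡ (X - Φ b) - ((Y - Φ (b ⊕ v a)) + Φ (b ⊕ v a))
      regroup = begin
        iteratedΔ v S (λ x → Φ (b ⊕ x) - Φ (b ⊕ (x ⊕ v a))) - Φ b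
          ≡⟨ cong (_- Φ b) (iteratedΔ-linear v S _ _) ⟩
        X - iteratedΔ v S (λ x → Φ (b ⊕ (x ⊕ v a))) - Φ b
          ≡⟨ cong (λ z → X - z - Φ b) (iteratedΔ-resp v S λ x → cong Φ (shift x)) ⟩
        X - Y - Φ b
          ≡⟨ rearrange X Y (Φ b) (Φ (b ⊕ v a)) ⟩
        (X - Φ b) - ((Y - Φ (b ⊕ v a)) + Φ (b ⊕ v a)) ∎
        where
        open ≡-Reasoning
        shift : ∀ x → b ⊕ (x ⊕ v a) ≡ (b ⊕ v a) ⊕ x
        shift x = trans (cong (b ⊕_) (⊕-comm x (v a))) (sym (⊕-assoc b (v a) x))
        rearrange : ∀ x y c e → x - y - c ≡ (x - c) - ((y - e) + e)
        rearrange = solve-∀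

    olson : ∀ S → ΣFin d N < length S →
            Σ (List A) λ T → T ⊆ S × 1 ≤ length T × IsZero (σ v T)
    olson S long with zeroSubsum⊎congruence S origin
    ... | inj₁ (T , T⊆S , T≢[] , z) = T , T⊆S , T≢[] , subst IsZero (⊕-identityˡ (σ v T)) z
    ... | inj₂ p∣Δ-Φ0 = contradiction (subst Prime (∣1⇒≡1 (∣⇒∣ᵤ p∣-1)) p-prime) ¬prime[1]
      where
      Δ≡0 : iteratedΔ v S (λ x → Φ (origin ⊕ x)) ≡ + 0
      Δ≡0 = iteratedΔ-vanishes v
              (Degree≤-resp (λ x → cong Φ (sym (⊕-identityˡ x))) (binomialProduct-degree N)) S long
      p∣-1 : + p ℤ.∣ + 0 - + 1
      p∣-1 = subst (λ z → + p ℤ.∣ z) (cong₂ _-_ Δ≡0 (binomialProduct-origin N)) p∣Δ-Φ0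

open import Data.Nat using (_+_; _*_)

private variable
  n : ℕ

δ : Fin n → Fin n → ℕ
δ j i = if does (j Fin.≟ i) then 1 else 0

δ≤1 : ∀ (j i : Fin n) → δ j i ≤ 1
δ≤1 j i with does (j Fin.≟ i)
... | true  = ℕ.≤-refl
... | false = z≤n

multiplicity : Fin n → List (Fin n) → ℕ
multiplicity i []       = 0
multiplicity i (j ∷ js) = δ j i + multiplicity i js

multiplicity-++ : ∀ (i : Fin n) js ks → multiplicity i (js ++ ks) ≡ multiplicity i js + multiplicity i ks
multiplicity-++ i []       ks = refl
multiplicity-++ i (j ∷ js) ks = trans (cong (δ j i +_) (multiplicity-++ i js ks)) (sym (ℕ.+-assoc (δ j i) _ _))

multiplicity-suc-replicate : ∀ (i : Fin n) k → multiplicity (Fin.suc i) (replicate k Fin.zero) ≡ 0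
multiplicity-suc-replicate i zero    = refl
multiplicity-suc-replicate i (suc k) = multiplicity-suc-replicate i k

multiplicity-zero-replicate : ∀ k → multiplicity {suc n} Fin.zero (replicate k Fin.zero) ≡ k
multiplicity-zero-replicate zero    = refl
multiplicity-zero-replicate (suc k) = cong suc (multiplicity-zero-replicate k)

multiplicity-zero-map-suc : ∀ (js : List (Fin n)) → multiplicity Fin.zero (map Fin.suc js) ≡ 0
multiplicity-zero-map-suc []       = refl
multiplicity-zero-map-suc (j ∷ js) = multiplicity-zero-map-suc js

multiplicity-suc-map-suc : ∀ (i : Fin n) js → multiplicity (Fin.suc i) (map Fin.suc js) ≡ multiplicity i js
multiplicity-suc-map-suc i []       = refl
multiplicity-suc-map-suc i (j ∷ js) = cong (δ j i +_) (multiplicity-suc-map-suc i js)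

replicateEach : (Fin n → ℕ) → List (Fin n)
replicateEach {zero}  c = []
replicateEach {suc n} c = replicate (c Fin.zero) Fin.zero ++ map Fin.suc (replicateEach (c ∘ Fin.suc))

length-replicateEach : (c : Fin n → ℕ) → length (replicateEach c) ≡ ΣFin n c
length-replicateEach {zero}  c = refl
length-replicateEach {suc n} c =
  trans (List.length-++ (replicate (c Fin.zero) Fin.zero))
        (cong₂ _+_ (List.length-replicate (c Fin.zero))
                   (trans (List.length-map Fin.suc (replicateEach (c ∘ Fin.suc)))
                          (length-replicateEach (c ∘ Fin.suc))))

multiplicity-replicateEach : (c : Fin n → ℕ) → ∀ i → multiplicity i (replicateEach c) ≡ c i
multiplicity-replicateEach {suc n} c Fin.zero =
  trans (multiplicity-++ Fin.zero (replicate (c Fin.zero) Fin.zero) _)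
        (trans (cong₂ _+_ (multiplicity-zero-replicate (c Fin.zero))
                          (multiplicity-zero-map-suc (replicateEach (c ∘ Fin.suc))))
               (ℕ.+-identityʳ (c Fin.zero)))
multiplicity-replicateEach {suc n} c (Fin.suc i) =
  trans (multiplicity-++ (Fin.suc i) (replicate (c Fin.zero) Fin.zero) _)
        (trans (cong₂ _+_ (multiplicity-suc-replicate i (c Fin.zero))
                          (multiplicity-suc-map-suc i (replicateEach (c ∘ Fin.suc))))
               (multiplicity-replicateEach (c ∘ Fin.suc) i))

module _ {A : Set} where

  complement : {xs ys : List A} → xs ⊆ ys → List A
  complement []       = []
  complement (y ∷ʳ τ) = y ∷ complement τ
  complement (_ ∷ τ)  = complement τ

  complement-⊆ : {xs ys : List A} (τ : xs ⊆ ys) → complement τ ⊆ ys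
  complement-⊆ []       = []
  complement-⊆ (y ∷ʳ τ) = refl ∷ complement-⊆ τ
  complement-⊆ (_ ∷ τ)  = _ ∷ʳ complement-⊆ τ

  length-complement : {xs ys : List A} (τ : xs ⊆ ys) → length (complement τ) + length xs ≡ length ys
  length-complement []           = refl
  length-complement (y ∷ʳ τ)     = cong suc (length-complement τ)
  length-complement (refl ∷ τ)   = trans (ℕ.+-suc _ _) (cong suc (length-complement τ))

m∣n⇒m<n⇒n<3m⇒n≡m+m : ∀ {m n} → m ∣ n → m < n → n < m + m + m → n ≡ m + m
m∣n⇒m<n⇒n<3m⇒n≡m+m {m} (divides zero refl) ()
m∣n⇒m<n⇒n<3m⇒n≡m+m {m} (divides (suc zero) refl) m<m _ = contradiction m<m (ℕ.<-irrefl (sym (ℕ.+-identityʳ m)))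
m∣n⇒m<n⇒n<3m⇒n≡m+m {m} (divides (suc (suc zero)) refl) _ _ = cong (m +_) (ℕ.+-identityʳ m)
m∣n⇒m<n⇒n<3m⇒n≡m+m {m} (divides (suc (suc (suc k))) refl) _ n<3m = contradiction 3m≤n (ℕ.<⇒≱ n<3m)
  where
  3m≤n : m + m + m ≤ m + (m + (m + k * m))
  3m≤n = ℕ.≤-trans (ℕ.≤-reflexive (ℕ.+-assoc m m m)) (ℕ.+-monoʳ-≤ m (ℕ.+-monoʳ-≤ m (ℕ.m≤m+n m (k * m))))

ΣFin-last : ∀ n (c : Fin (suc n) → ℕ) → ΣFin (suc n) c ≡ ΣFin n (c ∘ Fin.inject₁) + c (Fin.fromℕ n)
ΣFin-last zero    c = ℕ.+-comm (c Fin.zero) 0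
ΣFin-last (suc n) c = trans (cong (c Fin.zero +_) (ΣFin-last n (c ∘ Fin.suc))) (sym (ℕ.+-assoc (c Fin.zero) _ _))

1+ΣFin<q+q : ∀ n (c : Fin (suc n) → ℕ) {q} → suc (c (Fin.fromℕ n)) ≡ q →
             suc (ΣFin n (c ∘ Fin.inject₁)) ≤ q → suc (ΣFin (suc n) c) < q + q
1+ΣFin<q+q n c refl small = begin-strict
  suc (ΣFin (suc n) c)                   ≡⟨ cong suc (ΣFin-last n c) ⟩
  suc (ΣFin n (c ∘ Fin.inject₁) + cₙ)    ≡⟨ ℕ.+-suc _ cₙ ⟨
  ΣFin n (c ∘ Fin.inject₁) + suc cₙ      <⟨ ℕ.+-monoˡ-< (suc cₙ) small ⟩
  suc cₙ + suc cₙ                        ∎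
  where
  open ℕ.≤-Reasoning
  cₙ = c (Fin.fromℕ n)

module GroupFacts (p : ℕ) {d : ℕ} (e : Fin d → ℕ) where

  open Group p d e

  HasShortZeroSum : ℕ → Seq → Set
  HasShortZeroSum m S = Σ Seq λ T → T ⊆ S × 1 ≤ length T × length T ≤ m × ZeroSum T

  HasShortZeroSum-⊆ : ∀ {m S S′} → S ⊆ S′ → HasShortZeroSum m S → HasShortZeroSum m S′
  HasShortZeroSum-⊆ S⊆S′ (T , T⊆S , rest) = T , ⊆-trans T⊆S S⊆S′ , rest

  EtaProp-mono : ∀ {m m′ k k′} → m ≤ m′ → k ≤ k′ → EtaProp m k → EtaProp m′ k′
  EtaProp-mono m≤m′ k≤k′ η S long with η S (ℕ.≤-trans k≤k′ long)
  ... | T , T⊆S , T≢[] , short , z = T , T⊆S , T≢[] , ℕ.≤-trans short m≤m′ , z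

  coordSum-mono : ∀ {T S} → T ⊆ S → ∀ i → coordSum T i ≤ coordSum S i
  coordSum-mono []       i = z≤n
  coordSum-mono (g ∷ʳ τ) i = ℕ.≤-trans (coordSum-mono τ i) (ℕ.m≤n+m _ (toℕ (g i)))
  coordSum-mono {g ∷ _} (refl ∷ τ) i = ℕ.+-monoʳ-≤ (toℕ (g i)) (coordSum-mono τ i)

  coordSum-complement : ∀ {T S} (τ : T ⊆ S) i → coordSum (complement τ) i + coordSum T i ≡ coordSum S i
  coordSum-complement []           i = refl
  coordSum-complement (g ∷ʳ τ)     i =
    trans (ℕ.+-assoc (toℕ (g i)) _ _) (cong (toℕ (g i) +_) (coordSum-complement τ i))
  coordSum-complement {g ∷ T} (refl ∷ τ) i =
    trans (x∙yz≈y∙xz (coordSum (complement τ) i) (toℕ (g i)) (coordSum T i))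
          (cong (toℕ (g i) +_) (coordSum-complement τ i))

  -- The terms of T after the first contain a nonempty zero-sum U; if U is long, its complement in T is short.
  halve : ∀ {k m T} → DProp k → ZeroSum T → k < length T → length T ≤ m + m → HasShortZeroSum m T
  halve {k} {m} {t ∷ T} D zT (s≤s k≤|T|) |T|≤2m with D T k≤|T|
  ... | U , U⊆T , U≢[] , zU with length U ℕ.≤? m
  ...   | yes short = U , t ∷ʳ U⊆T , U≢[] , short , zU
  ...   | no long = complement τ , complement-⊆ τ , s≤s z≤n , |C|≤m , zC
    where
    τ = t ∷ʳ U⊆T
    |C|≤m : length (complement τ) ≤ m
    |C|≤m = ℕ.+-cancelʳ-≤ (length U) _ m (begin
      length (complement τ) + length U ≡⟨ length-complement τ ⟩
      length (t ∷ T)                   ≤⟨ |T|≤2m ⟩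
      m + m                            ≤⟨ ℕ.+-monoʳ-≤ m (ℕ.<⇒≤ (ℕ.≰⇒> long)) ⟩
      m + length U                     ∎)
      where open ℕ.≤-Reasoning
    zC : ZeroSum (complement τ)
    zC i = ∣m+n∣m⇒∣n (subst (p ^ e i ∣_) (trans (sym (coordSum-complement τ i)) (ℕ.+-comm _ (coordSum U i))) (zT i))
                     (zU i)

  embed : Elem → Point d
  embed g = tabulate (toℕ ∘ g)

  lookup-σ : ∀ {m} (v : Elem → Point m) j i → (∀ g → lookup (v g) j ≡ toℕ (g i)) →
             ∀ T → lookup (σ v T) j ≡ coordSum T i
  lookup-σ v j i v[j]≡g[i] []      = Vec.lookup-replicate j 0
  lookup-σ v j i v[j]≡g[i] (g ∷ T) =
    trans (Vec.lookup-zipWith _+_ j (v g) (σ v T)) (cong₂ _+_ (v[j]≡g[i] g) (lookup-σ v j i v[j]≡g[i] T))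

  lookup-σ-embed : ∀ T i → lookup (σ embed T) i ≡ coordSum T i
  lookup-σ-embed T i = lookup-σ embed i i (λ g → Vec.lookup∘tabulate (toℕ ∘ g) i) T

module PrimePowerGroup {p : ℕ} (p-prime : Prime p) {d : ℕ} (e : Fin d → ℕ) where

  open Group p d e
  open GroupFacts p e

  private instance
    p≢0 = prime⇒nonZero p-prime
    p≢1 = prime⇒nonTrivial p-prime

  p^e∸1 : Fin d → ℕ
  p^e∸1 i = p ^ e i ∸ 1

  1+p^e∸1≡p^e : ∀ i → suc (p^e∸1 i) ≡ p ^ e i
  1+p^e∸1≡p^e i = ℕ.m+[n∸m]≡n (ℕ.m^n>0 p (e i))

  d* : ℕ
  d* = ΣFin d p^e∸1

  olsonBound : DProp (suc d*)
  olsonBound S long with Olson.olson p-prime e embed S long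
  ... | T , T⊆S , T≢[] , z = T , T⊆S , T≢[] , λ i → subst (p ^ e i ∣_) (lookup-σ-embed T i) (z i)

  module _ (j : Fin d) where

    private
      q = p ^ e j

    -- lift maps G into C_q × G (exponents e′) by g ↦ (1, g), so the first coordinate of a sum counts its terms.
    e′ : Fin (suc d) → ℕ
    e′ Fin.zero    = e j
    e′ (Fin.suc i) = e i

    lift : Elem → Point (suc d)
    lift g = 1 ∷ embed g

    lookup-σ-lift-zero : ∀ T → lookup (σ lift T) Fin.zero ≡ length T
    lookup-σ-lift-zero []      = refl
    lookup-σ-lift-zero (g ∷ T) =
      trans (Vec.lookup-zipWith _+_ Fin.zero (lift g) (σ lift T)) (cong suc (lookup-σ-lift-zero T))

    lifted-zeroSum : ∀ {T} → IsZeroMod (λ i → p ^ e′ i) (σ lift T) → ZeroSum T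
    lifted-zeroSum {T} z i =
      subst (p ^ e i ∣_) (lookup-σ lift (Fin.suc i) i (λ g → Vec.lookup∘tabulate (toℕ ∘ g) i) T) (z (Fin.suc i))

    lifted-shortZeroSum : suc d* < q + q → ∀ {T} → 1 ≤ length T → length T < q + q + q →
                          IsZeroMod (λ i → p ^ e′ i) (σ lift T) → HasShortZeroSum q T
    lifted-shortZeroSum small {T} T≢[] |T|<3q z with length T ℕ.≤? q
    ... | yes short = T , Sublist.⊆-refl , T≢[] , short , lifted-zeroSum {T} z
    ... | no ¬short =
      halve olsonBound (lifted-zeroSum {T} z) (subst (suc d* <_) (sym |T|≡2q) small) (ℕ.≤-reflexive |T|≡2q)
      where
      q∣|T| : q ∣ length T
      q∣|T| = subst (q ∣_) (lookup-σ-lift-zero T) (z Fin.zero)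
      |T|≡2q : length T ≡ q + q
      |T|≡2q = m∣n⇒m<n⇒n<3m⇒n≡m+m q∣|T| (ℕ.≰⇒> ¬short) |T|<3q

    etaBound : suc d* < q + q → EtaProp q (d* + q)
    etaBound small S long with Olson.olson p-prime e′ lift (take (d* + q) S) long′
      where
      long′ : p^e∸1 j + d* < length (take (d* + q) S)
      long′ = ℕ.≤-reflexive (begin
        suc (p^e∸1 j) + d*         ≡⟨ cong (_+ d*) (1+p^e∸1≡p^e j) ⟩
        q + d*                     ≡⟨ ℕ.+-comm q d* ⟩
        d* + q                     ≡⟨ ℕ.m≤n⇒m⊓n≡m long ⟨
        (d* + q) ℕ.⊓ length S      ≡⟨ List.length-take (d* + q) S ⟨
        length (take (d* + q) S)   ∎)
        where open ≡-Reasoning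
    ... | T , T⊆ , T≢[] , z =
      HasShortZeroSum-⊆ (⊆-trans T⊆ (take-⊆ _ S)) (lifted-shortZeroSum small T≢[] |T|<3q z)
      where
      open ℕ.≤-Reasoning
      |T|<3q : length T < q + q + q
      |T|<3q = begin-strict
        length T                   ≤⟨ length-mono-≤ T⊆ ⟩
        length (take (d* + q) S)   ≡⟨ List.length-take (d* + q) S ⟩
        (d* + q) ℕ.⊓ length S      ≤⟨ ℕ.m⊓n≤m _ _ ⟩
        d* + q                     <⟨ ℕ.+-monoˡ-< q (ℕ.<-trans (ℕ.n<1+n d*) small) ⟩
        q + q + q                  ∎

  module _ (1≤e : ∀ i → 1 ≤ e i) where

    1<p^e : ∀ i → 1 < p ^ e i
    1<p^e i =
      ℕ.<-≤-trans (nonTrivial⇒n>1 p) (subst (_≤ p ^ e i) (ℕ.*-identityʳ p) (ℕ.^-monoʳ-≤ p (1≤e i)))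

    unit : Fin d → Elem
    unit j i = fromℕ< (ℕ.≤-<-trans (δ≤1 j i) (1<p^e i))

    toℕ-unit : ∀ j i → toℕ (unit j i) ≡ δ j i
    toℕ-unit j i = Fin.toℕ-fromℕ< _

    toℕ-unit-diag : ∀ j → toℕ (unit j j) ≡ 1
    toℕ-unit-diag j = trans (toℕ-unit j j) (cong (λ b → if b then 1 else 0) (dec-true (j Fin.≟ j) refl))

    coordSum-map-unit : ∀ J i → coordSum (map unit J) i ≡ multiplicity i J
    coordSum-map-unit []      i = refl
    coordSum-map-unit (j ∷ J) i = cong₂ _+_ (toℕ-unit j i) (coordSum-map-unit J i)

    unitSequence : Seq
    unitSequence = map unit (replicateEach p^e∸1)

    unitSequence-zeroSumFree : ∀ {T} → T ⊆ unitSequence → 1 ≤ length T → ¬ ZeroSum T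
    unitSequence-zeroSumFree {t ∷ T} τ _ zT with ∈-map⁻ unit (Sublist.lookup τ (here refl))
    ... | j , _ , refl = ℕ.<-irrefl refl (ℕ.<-≤-trans σ<p^e (∣⇒≤ {{ℕ.>-nonZero 0<σ}} (zT j)))
      where
      0<σ : 0 < coordSum (unit j ∷ T) j
      0<σ = subst (λ x → 0 < x + coordSum T j) (sym (toℕ-unit-diag j)) (s≤s z≤n)
      σ<p^e : coordSum (unit j ∷ T) j < p ^ e j
      σ<p^e = begin-strict
        coordSum (unit j ∷ T) j                         ≤⟨ coordSum-mono τ j ⟩
        coordSum unitSequence j                         ≡⟨ coordSum-map-unit (replicateEach p^e∸1) j ⟩
        multiplicity j (replicateEach p^e∸1)            ≡⟨ multiplicity-replicateEach p^e∸1 j ⟩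
        p^e∸1 j                                         <⟨ ℕ.≤-reflexive (1+p^e∸1≡p^e j) ⟩
        p ^ e j                                         ∎
        where open ℕ.≤-Reasoning

    d*<D : ∀ {D} → IsDavenport D → d* < D
    d*<D {D} (_ , D-prop , _) = ℕ.≰⇒> λ D≤d* →
      let T , T⊆ , T≢[] , zT = D-prop unitSequence (subst (D ≤_) (sym length-unitSequence) D≤d*)
      in unitSequence-zeroSumFree T⊆ T≢[] zT
      where
      length-unitSequence : length unitSequence ≡ d*
      length-unitSequence = trans (List.length-map unit (replicateEach p^e∸1)) (length-replicateEach p^e∸1)

    p^e≤exp : ∀ {ex} → IsExp ex → ∀ j → p ^ e j ≤ ex
    p^e≤exp {ex} (1≤ex , kills , _) j =
      ∣⇒≤ {{ℕ.>-nonZero 1≤ex}} (subst (p ^ e j ∣_) ex*1≡ex (kills (unit j) j))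
      where
      ex*1≡ex : ex * toℕ (unit j j) ≡ ex
      ex*1≡ex = trans (cong (ex *_) (toℕ-unit-diag j)) (ℕ.*-identityʳ ex)

    η≤D+exp : ∀ j → suc d* < p ^ e j + p ^ e j →
              ∀ {ex D η} → IsExp ex → IsDavenport D → IsEta ex η → η ≤ D + ex
    η≤D+exp j small {ex} {D} isExp isD (_ , _ , η-minimal) =
      η-minimal (D + ex) (ℕ.≤-trans (proj₁ isD) (ℕ.m≤m+n D ex))
        (EtaProp-mono q≤ex (ℕ.+-mono-≤ (ℕ.<⇒≤ (d*<D isD)) q≤ex) (etaBound j small))
      where
      q≤ex : p ^ e j ≤ ex
      q≤ex = p^e≤exp isExp j

open import Defs
open import Data.Nat using (ℕ; suc; _+_; _∸_; _^_; _≤_)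
open import Data.Nat.Primality using (Prime)
open import Data.Fin using (Fin; fromℕ; inject₁; _≤_)

lemma10 : (p : ℕ) → Prime p → (n : ℕ) → (e : Fin (suc n) → ℕ)
    → ((i : Fin (suc n)) → 1 Data.Nat.≤ e i)
    → ((i j : Fin (suc n)) → i Data.Fin.≤ j → e i Data.Nat.≤ e j)
    → 1 + ΣFin n (λ i → p ^ e (inject₁ i) ∸ 1) Data.Nat.≤ p ^ e (fromℕ n)
    → (ex D η : ℕ)
    → Group.IsExp p (suc n) e ex
    → Group.IsDavenport p (suc n) e D
    → Group.IsEta p (suc n) e ex η
    → η Data.Nat.≤ D + ex
lemma10 p p-prime n e 1≤e _ small ex D η =
  -- The ordering of the exponents is not needed: any coordinate j with 1 + d* < 2 p^(e j) will do.
  η≤D+exp 1≤e (fromℕ n) (1+ΣFin<q+q n p^e∸1 (1+p^e∸1≡p^e (fromℕ n)) small)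
  where open PrimePowerGroup p-prime e
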